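{- Let $F$ be a set, $\mathcal D$ a filter on $F$, and $\psi$ a formula of $L(\Sigma_2^g)$ that is infrafiltrated with respect to $\mathcal D$. Then for every variable $x^\tau$ the formula $\exists x^\tau\psi$ is infrafiltrated with respect to $\mathcal D$ as well.
   Context: Types: $0$ is the first-order type; for $k\ge0$, $[\tau_0,\ldots,\tau_k]$ with all $\tau_\mu=0$ is a second-order type; for a set $A$, $0(A)=A$, $\check\tau(A)=A^{k+1}$, $\tau(A)=\mathcal P(A^{k+1})$. A generalized second-order signature $\Sigma_2^g$ has a set $\Theta$ of first- and second-order types (containing $0$ and some second-order type), $\Theta_b$ its second-order types, constant symbols $\sigma^\tau_\omega$, binary predicate symbols $\delta_\tau$ ($\tau\in\Theta$), $\varepsilon_\tau$ ($\tau\in\Theta_b$), and variables of each type; atomic formulas $q\,\delta_\tau\,r$ and $(q_0,\ldots,q_k)\,\varepsilon_\tau\,r$ (terms are constants or variables), formulas built with $\lnot,\land,\lor,\Rightarrow,\exists,\forall$. A system $U=\langle A,S\rangle$: a set $A$, constants $s^\tau_\omega\in\tau(A)$, $\approx_\tau\subseteq\tau(A)^2$ containing identity, $\tilde\in_\tau\subseteq\check\tau(A)\times\tau(A)$ containing membership. Evaluations $\gamma$ assign $\gamma(x^\tau)\in\tau(A)$; $U\vDash(q\delta_\tau r)[\gamma]$ iff $q[\gamma]\approx_\tau r[\gamma]$, $U\vDash((q_\mu)_\mu\varepsilon_\tau r)[\gamma]$ iff $(q_\mu[\gamma])_\mu\mathrel{\tilde\in_\tau}r[\gamma]$, connectives usual,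 $U\vDash(\exists x^\tau\psi)[\gamma]$ iff $U\vDash\psi[\gamma']$ for some $\gamma'$ agreeing with $\gamma$ off $x^\tau$ (and $\forall$ with "every"). $U$ has true generalized equalities and belongings if each $\approx_\tau$ is an equivalence relation and $x_\mu\approx y_\mu$, $u\approx_\tau v$ imply $((x_\mu)\mathrel{\tilde\in_\tau}u\Leftrightarrow(y_\mu)\mathrel{\tilde\in_\tau}v)$. Infra-$\mathcal D$-product $\mathrm{Inf}_{\mathcal D}\prod_fU_f$ of $U_f=\langle A_f,S_f\rangle$: support $A=\prod_fA_f$; $p(f)(\mu)=p(\mu)(f)$ for $p\in A^{k+1}$; $P\langle f\rangle=\{p(f):p\in P\}$; constants $s^0_\omega(f)=s^0_{\omega f}$, $s^\tau_\omega=\{p:\forall f\ p(f)\in s^\tau_{\omega f}\}$ for second-order $\tau$; $p\approx_0q$ iff $\exists G\in\mathcal D\,\forall g\in G\ p(g)\approx_{0,g}q(g)$; $P\approx_\tau Q$ iff $\exists G\in\mathcal D\,\forall g\in G\ P\langle g\rangle\approx_{\tau,g}Q\langle g\rangle$; $p\mathrel{\tilde\in_\tau}P$ iff $\exists G\in\mathcal D\,\forall g\in G\ p(g)\mathrel{\tilde\in_{\tau,g}}P\langle g\rangle$. Crossing $\bowtie_f\gamma_f$: $\gamma(x)(f)=\gamma_f(x)$ for type $0$, $\gamma(x)=\{p:\forall f\ p(f)\in\gamma_f(x)\}$ for second-order types. A formula $\varphi$ is infrafiltrated with respect to $\mathcal D$ if for every collection $(\langle U_f,\gamma_f\rangle)_{f\in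 F}$ of evaluated systems of signature $\Sigma_2^g$ with true generalized equalities and belongings: $\mathrm{Inf}_{\mathcal D}\prod_fU_f\vDash\varphi[\bowtie_f\gamma_f]$ iff $\{g\in F:U_g\vDash\varphi[\gamma_g]\}\in\mathcal D$. A filter: family of subsets closed under finite intersections and supersets. -}

module Defs where

open import Level using (Lift; lift; lower) renaming (suc to lsuc; zero to lzero)
open import Data.Nat using (ℕ; zero; suc) renaming (_≟_ to _≟ℕ_)
open import Data.Bool using (Bool; true; false; T; _∧_)
open import Data.Unit using (⊤)
open import Data.Empty using (⊥)
open import Data.Fin using (Fin)
open import Data.Vec using (Vec; map; lookup)
open import Data.Product using (Σ; _×_; _,_; ∃)
open import Data.Sum using (_⊎_)
open import Relation.Nullary using (¬_; Dec; yes; no)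
open import Relation.Binary.PropositionalEquality using (_≡_; refl)
open import Relation.Binary.Structures using (IsEquivalence)
open import Function.Bundles using (_⇔_)

data Ty : Set where
  fo : Ty
  so : ℕ → Ty      -- so k = [τ₀,…,τ_k] with all τ_μ = 0

so-inj : ∀ {k l} → so k ≡ so l → k ≡ l
so-inj refl = refl

_≟Ty_ : (σ τ : Ty) → Dec (σ ≡ τ)
fo ≟Ty fo = yes refl
fo ≟Ty so _ = no λ ()
so _ ≟Ty fo = no λ ()
so k ≟Ty so l with k ≟ℕ l
... | yes refl = yes refl
... | no k≢l = no λ e → k≢l (so-inj e)

Sub : Set → ℕ → Set₁
Sub A k = Vec A (suc k) → Set

Val : Set → Ty → Set₁
Val A fo = Lift (lsuc lzero) A
Val A (so k) = Sub A k

_≐_ : ∀ {A τ} → Val A τ → Val A τ → Set₁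
_≐_ {A} {fo} a b = a ≡ b
_≐_ {A} {so k} P Q = Lift (lsuc lzero) (∀ p → (P p → Q p) × (Q p → P p))

record Signature : Set₁ where
  field
    Θ   : Ty → Set
    Θ₀  : Θ fo
    Θb  : Σ ℕ (λ k → Θ (so k))
    Con : Ty → Set
open Signature public

module _ (S : Signature) where

  data Term (τ : Ty) : Set where
    con : Θ S τ → Con S τ → Term τ
    var : Θ S τ → ℕ → Term τ

  data Formula : Set where
    eqF  : ∀ {τ} → Θ S τ → Term τ → Term τ → Formula
    memF : ∀ {k} → Θ S (so k) → Vec (Term fo) (suc k) → Term (so k) → Formula
    notF : Formula → Formula
    andF orF impF : Formula → Formula → Formula
    exF allF : (τ : Ty) → Θ S τ → ℕ → Formula → Formula

record RawSystem (S : Signature) : Set₂ where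
  field
    A      : Set
    const  : (τ : Ty) → Con S τ → Val A τ
    approx : (τ : Ty) → Val A τ → Val A τ → Set₁
    bel    : (k : ℕ) → Vec A (suc k) → Sub A k → Set₁
open RawSystem public

record IsSystem {S : Signature} (U : RawSystem S) : Set₂ where
  field
    approx-id : ∀ τ (u v : Val (A U) τ) → u ≐ v → approx U τ u v
    bel-mem   : ∀ k (p : Vec (A U) (suc k)) (P : Sub (A U) k) → P p → bel U k p P

record TrueGE {S : Signature} (U : RawSystem S) : Set₂ where
  field
    approx-equiv : ∀ τ → IsEquivalence (approx U τ)
    bel-cong : ∀ k (x y : Vec (A U) (suc k)) (u v : Sub (A U) k) →
               (∀ i → approx U fo (lift (lookup x i)) (lift (lookup y i))) →
               approx U (so k) u v →
               (bel U k x u ⇔ bel U k y v)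

Eval : Set → Set₁
Eval A = (τ : Ty) → ℕ → Val A τ

update : ∀ {A} → Eval A → (τ : Ty) → ℕ → Val A τ → Eval A
update γ τ n v σ m with σ ≟Ty τ | m ≟ℕ n
... | yes refl | yes _ = v
... | _        | _     = γ σ m

module _ {S : Signature} (U : RawSystem S) where

  ⟦_⟧ : ∀ {τ} → Term S τ → Eval (A U) → Val (A U) τ
  ⟦_⟧ {τ} (con _ c) γ = const U τ c
  ⟦_⟧ {τ} (var _ n) γ = γ τ n

  Sat : Formula S → Eval (A U) → Set₁
  Sat (eqF {τ} _ q r) γ = approx U τ (⟦ q ⟧ γ) (⟦ r ⟧ γ)
  Sat (memF {k} _ qs r) γ = bel U k (map (λ q → lower (⟦ q ⟧ γ)) qs) (⟦ r ⟧ γ)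
  Sat (notF φ) γ = ¬ Sat φ γ
  Sat (andF φ ψ) γ = Sat φ γ × Sat ψ γ
  Sat (orF φ ψ) γ = Sat φ γ ⊎ Sat ψ γ
  Sat (impF φ ψ) γ = Sat φ γ → Sat ψ γ
  Sat (exF τ _ n φ) γ = Σ (Val (A U) τ) (λ v → Sat φ (update γ τ n v))
  Sat (allF τ _ n φ) γ = (v : Val (A U) τ) → Sat φ (update γ τ n v)

record Filter (F : Set) : Set₁ where
  field
    D     : (F → Bool) → Set
    full  : D (λ _ → true)
    inter : ∀ {G H} → D G → D H → D (λ g → G g ∧ H g)
    up    : ∀ {G H} → D G → (∀ g → T (G g) → T (H g)) → D H
open Filter public

-- "∃ G ∈ 𝒟 ∀ g ∈ G, X g"; for X itself a subset this is X ∈ 𝒟.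
InD : ∀ {F : Set} → Filter F → (F → Set₁) → Set₁
InD {F} 𝒟 X = Σ (F → Bool) (λ G → D 𝒟 G × (∀ g → T (G g) → X g))

module _ {S : Signature} {F : Set} (𝒟 : Filter F) (U : F → RawSystem S) where

  ΠA : Set
  ΠA = (f : F) → A (U f)

  at : ∀ {k} → Vec ΠA (suc k) → (f : F) → Vec (A (U f)) (suc k)
  at p f = map (λ a → a f) p

  _⟨_⟩ : ∀ {k} → Sub ΠA k → (f : F) → Sub (A (U f)) k
  P ⟨ f ⟩ = λ q → Σ (Vec ΠA _) (λ p → P p × at p f ≡ q)

  InfProd : RawSystem S
  A InfProd = ΠA
  const InfProd fo c = lift (λ f → lower (const (U f) fo c))
  const InfProd (so k) c = λ p → ∀ f → const (U f) (so k) c (at p f)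
  approx InfProd fo p q =
    InD 𝒟 (λ g → approx (U g) fo (lift (lower p g)) (lift (lower q g)))
  approx InfProd (so k) P Q =
    InD 𝒟 (λ g → approx (U g) (so k) (P ⟨ g ⟩) (Q ⟨ g ⟩))
  bel InfProd k p P = InD 𝒟 (λ g → bel (U g) k (at p g) (P ⟨ g ⟩))

  cross : ((f : F) → Eval (A (U f))) → Eval ΠA
  cross γs fo n = lift (λ f → lower (γs f fo n))
  cross γs (so k) n = λ p → ∀ f → γs f (so k) n (at p f)

Infrafiltrated : {S : Signature} {F : Set} → Filter F → Formula S → Set₂
Infrafiltrated {S} {F} 𝒟 φ =
  (U : F → RawSystem S) →
  ((f : F) → IsSystem (U f)) →
  ((f : F) → TrueGE (U f)) →
  (γs : (f : F) → Eval (A (U f))) →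
  Sat (InfProd 𝒟 U) φ (cross 𝒟 U γs) ⇔ InD 𝒟 (λ g → Sat (U g) φ (γs g))

module Submission where

-- Two elements of τ(∏A_f) are called indistinguishable when they have the same
-- coordinates: first-order elements agree at every f, second-order elements P, Q
-- have extensionally equal shadows P⟨g⟩, Q⟨g⟩ at every g.  Every atomic relation
-- of the infra-product only looks at coordinates (for ≈ and ∈̃ this uses that the
-- factors contain identity and have true equalities and belongings), so
-- satisfaction in the infra-product is invariant under replacing an evaluation by
-- a pointwise indistinguishable one (Sat-invariant).  Crossing commutes with
-- updating a variable up to indistinguishability (cross-update).  The theorem
-- then follows in both directions:
--  (⇒) a witness v in the product yields the witnesses v⟨f⟩ in the factors;
--  (⇐) witnesses given on a set G ∈ 𝒟 are extended by the old values off G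
--      (InD-choice, which is constructive since subsets are Bool-valued), and
--      their crossing is a witness in the product.

open import Defs
open import Data.Nat using (ℕ; suc) renaming (_≟_ to _≟ℕ_)
open import Level using (lift; lower; 0ℓ) renaming (suc to lsuc)
open import Data.Bool using (Bool; true; false; T)
open import Data.Unit using (tt)
open import Data.Empty using (⊥-elim)
open import Data.Vec using (Vec; map; lookup)
open import Data.Vec.Properties using (lookup-map)
open import Data.Product using (Σ; _×_; _,_; proj₁; proj₂)
open import Data.Product.Function.NonDependent.Propositional using (_×-⇔_)
open import Data.Sum.Function.Propositional using (_⊎-⇔_)
open import Relation.Nullary using (¬_; Dec; yes; no)
open import Relation.Binary.Bundles using (Setoid)
open import Relation.Binary.Structures using (IsEquivalence)
open import Relation.Binary.PropositionalEquality
  using (_≡_; refl; sym; trans; cong; subst; subst₂; module ≡-Reasoning)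
open import Function.Bundles using (_⇔_; mk⇔; Equivalence)
open import Function.Related.TypeIsomorphisms using (→-cong-⇔; ¬-cong-⇔)
import Relation.Binary.Reasoning.Setoid as SetoidReasoning

open Equivalence using (to; from)

update-here : ∀ {A} (γ : Eval A) τ n v → update γ τ n v τ n ≡ v
update-here γ τ n v with τ ≟Ty τ | n ≟ℕ n
... | yes refl | yes _  = refl
... | yes refl | no n≢n = ⊥-elim (n≢n refl)
... | no τ≢τ   | _      = ⊥-elim (τ≢τ refl)

update-elsewhere : ∀ {A} (γ : Eval A) τ n v σ m →
                   ¬ (σ ≡ τ × m ≡ n) → update γ τ n v σ m ≡ γ σ m
update-elsewhere γ τ n v σ m ne with σ ≟Ty τ | m ≟ℕ n
... | yes refl | yes m≡n = ⊥-elim (ne (refl , m≡n))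
... | yes refl | no _    = refl
... | no _     | yes _   = refl
... | no _     | no _    = refl

same-variable? : ∀ (σ τ : Ty) (m n : ℕ) → Dec (σ ≡ τ × m ≡ n)
same-variable? σ τ m n with σ ≟Ty τ | m ≟ℕ n
... | yes σ≡τ | yes m≡n = yes (σ≡τ , m≡n)
... | no σ≢τ  | _       = no (λ e → σ≢τ (proj₁ e))
... | yes _   | no m≢n  = no (λ e → m≢n (proj₂ e))

InD-mono : ∀ {F} (𝒟 : Filter F) {X Y : F → Set₁} →
           (∀ g → X g → Y g) → InD 𝒟 X → InD 𝒟 Y
InD-mono 𝒟 X⇒Y (G , G∈𝒟 , onG) = G , G∈𝒟 , λ g g∈G → X⇒Y g (onG g g∈G)

extend : ∀ {X : Set₁} {P : X → Set₁} (b : Bool) → (T b → Σ X P) → X → X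
extend true  w _ = proj₁ (w tt)
extend false _ d = d

extend-spec : ∀ {X : Set₁} {P : X → Set₁} (b : Bool) (t : T b)
              (w : T b → Σ X P) (d : X) → P (extend b w d)
extend-spec true tt w d = proj₂ (w tt)

InD-choice : ∀ {F} (𝒟 : Filter F) {X : F → Set₁} {P : ∀ g → X g → Set₁} →
             ((g : F) → X g) → InD 𝒟 (λ g → Σ (X g) (P g)) →
             Σ ((g : F) → X g) (λ w → InD 𝒟 (λ g → P g (w g)))
InD-choice 𝒟 default (G , G∈𝒟 , onG) =
  (λ g → extend (G g) (onG g) (default g)) ,
  G , G∈𝒟 , λ g g∈G → extend-spec (G g) g∈G (onG g) (default g)

module Indistinguishability {S : Signature} {F : Set} (𝒟 : Filter F)
                            (U : F → RawSystem S) where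

  Π : RawSystem S
  Π = InfProd 𝒟 U

  PA : Set
  PA = ΠA 𝒟 U

  _⟪_⟫ : ∀ {k} → Sub PA k → (f : F) → Sub (A (U f)) k
  P ⟪ f ⟫ = _⟨_⟩ 𝒟 U P f

  Indist : (σ : Ty) → Val PA σ → Val PA σ → Set
  Indist fo     a b = ∀ g → lower a g ≡ lower b g
  Indist (so k) P Q = ∀ g q → (P ⟪ g ⟫) q ⇔ (Q ⟪ g ⟫) q

  Indist-isEquivalence : ∀ σ → IsEquivalence (Indist σ)
  Indist-isEquivalence fo = record
    { refl  = λ g → refl
    ; sym   = λ a~b g → sym (a~b g)
    ; trans = λ a~b b~c g → trans (a~b g) (b~c g) }
  Indist-isEquivalence (so k) = record
    { refl  = λ g q → mk⇔ (λ x → x) (λ x → x)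
    ; sym   = λ P~Q g q → mk⇔ (from (P~Q g q)) (to (P~Q g q))
    ; trans = λ P~Q Q~R g q → mk⇔ (λ x → to (Q~R g q) (to (P~Q g q) x))
                                  (λ x → from (P~Q g q) (from (Q~R g q) x)) }

  Indist-setoid : Ty → Setoid (lsuc 0ℓ) 0ℓ
  Indist-setoid σ = record { isEquivalence = Indist-isEquivalence σ }

  module Indist (σ : Ty) = IsEquivalence (Indist-isEquivalence σ)

  IndistEval : Eval PA → Eval PA → Set
  IndistEval γ γ' = ∀ σ m → Indist σ (γ σ m) (γ' σ m)

  IndistEval-sym : ∀ {γ γ'} → IndistEval γ γ' → IndistEval γ' γ
  IndistEval-sym γ~γ' σ m = Indist.sym σ (γ~γ' σ m)

  IndistEval-trans : ∀ {γ γ' γ''} → IndistEval γ γ' → IndistEval γ' γ'' → IndistEval γ γ''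
  IndistEval-trans γ~γ' γ'~γ'' σ m = Indist.trans σ (γ~γ' σ m) (γ'~γ'' σ m)

  update-cong : ∀ {γ γ'} → IndistEval γ γ' → ∀ τ n {v v'} → Indist τ v v' →
                IndistEval (update γ τ n v) (update γ' τ n v')
  update-cong γ~γ' τ n v~v' σ m with σ ≟Ty τ | m ≟ℕ n
  ... | yes refl | yes _ = v~v'
  ... | yes refl | no _  = γ~γ' σ m
  ... | no _     | yes _ = γ~γ' σ m
  ... | no _     | no _  = γ~γ' σ m

  term-cong : ∀ {γ γ'} → IndistEval γ γ' → ∀ {σ} (t : Term S σ) →
              Indist σ (⟦_⟧ Π t γ) (⟦_⟧ Π t γ')
  term-cong γ~γ' {σ} (con _ c) = Indist.refl σ
  term-cong γ~γ' {σ} (var _ m) = γ~γ' σ m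

  crossVal : ∀ σ → ((f : F) → Val (A (U f)) σ) → Val PA σ
  crossVal fo     w = lift (λ f → lower (w f))
  crossVal (so k) w = λ p → ∀ f → w f (at 𝒟 U p f)

  proj : ∀ σ → Val PA σ → (f : F) → Val (A (U f)) σ
  proj fo     v f = lift (lower v f)
  proj (so k) v f = v ⟪ f ⟫

  cross-at : ∀ γs σ m → cross 𝒟 U γs σ m ≡ crossVal σ (λ f → γs f σ m)
  cross-at γs fo     m = refl
  cross-at γs (so k) m = refl

  crossVal-cong : ∀ σ {w w' : (f : F) → Val (A (U f)) σ} →
                  (∀ f → w f ≡ w' f) → Indist σ (crossVal σ w) (crossVal σ w')
  crossVal-cong fo     w≡w' g = cong lower (w≡w' g)
  crossVal-cong (so k) w≡w' g q = mk⇔ (transport w≡w') (transport (λ f → sym (w≡w' f)))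
    where
    transport : ∀ {w w'} → (∀ f → w f ≡ w' f) →
                (crossVal (so k) w ⟪ g ⟫) q → (crossVal (so k) w' ⟪ g ⟫) q
    transport e (p , wp , p≡q) = p , (λ f → subst (λ W → W (at 𝒟 U p f)) (e f) (wp f)) , p≡q

  crossVal-proj : ∀ σ (v : Val PA σ) → Indist σ v (crossVal σ (proj σ v))
  crossVal-proj fo     v g   = refl
  crossVal-proj (so k) v g q =
    mk⇔ (λ (p , vp , p≡q) → p , (λ f → p , vp , refl) , p≡q)
        (λ (p , shadows , p≡q) → let (p' , vp' , p'≡p) = shadows g in
                                 p' , vp' , trans p'≡p p≡q)

  update-each : ((f : F) → Eval (A (U f))) → ∀ τ n → ((f : F) → Val (A (U f)) τ) →
                (f : F) → Eval (A (U f))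
  update-each γs τ n ws f = update (γs f) τ n (ws f)

  cross-update : ∀ γs τ n (ws : (f : F) → Val (A (U f)) τ) →
                 IndistEval (cross 𝒟 U (update-each γs τ n ws))
                            (update (cross 𝒟 U γs) τ n (crossVal τ ws))
  cross-update γs τ n ws σ m with same-variable? σ τ m n
  ... | yes (refl , refl) = begin
        cross 𝒟 U δs τ n                           ≡⟨ cross-at δs τ n ⟩
        crossVal τ (λ f → δs f τ n)                ≈⟨ crossVal-cong τ (λ f → update-here (γs f) τ n (ws f)) ⟩
        crossVal τ ws                              ≡⟨ update-here (cross 𝒟 U γs) τ n (crossVal τ ws) ⟨
        update (cross 𝒟 U γs) τ n (crossVal τ ws) τ n ∎
    where
    open SetoidReasoning (Indist-setoid τ)
    δs : (f : F) → Eval (A (U f))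
    δs = update-each γs τ n ws
  ... | no ne = begin
        cross 𝒟 U δs σ m                           ≡⟨ cross-at δs σ m ⟩
        crossVal σ (λ f → δs f σ m)                ≈⟨ crossVal-cong σ (λ f → update-elsewhere (γs f) τ n (ws f) σ m ne) ⟩
        crossVal σ (λ f → γs f σ m)                ≡⟨ cross-at γs σ m ⟨
        cross 𝒟 U γs σ m                           ≡⟨ update-elsewhere (cross 𝒟 U γs) τ n (crossVal τ ws) σ m ne ⟨
        update (cross 𝒟 U γs) τ n (crossVal τ ws) σ m ∎
    where
    open SetoidReasoning (Indist-setoid σ)
    δs : (f : F) → Eval (A (U f))
    δs = update-each γs τ n ws

  module _ (sys : ∀ f → IsSystem (U f)) (tge : ∀ f → TrueGE (U f)) where

    Indist⇒approx : ∀ {k} {P Q : Sub PA k} → Indist (so k) P Q →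
                    ∀ g → approx (U g) (so k) (P ⟪ g ⟫) (Q ⟪ g ⟫)
    Indist⇒approx {k} P~Q g =
      IsSystem.approx-id (sys g) (so k) _ _ (lift (λ q → to (P~Q g q) , from (P~Q g q)))

    approx-resp : ∀ σ {a b a' b' : Val PA σ} → Indist σ a a' → Indist σ b b' →
                  approx Π σ a b → approx Π σ a' b'
    approx-resp fo a~a' b~b' = InD-mono 𝒟 λ g →
      subst₂ (λ u w → approx (U g) fo (lift u) (lift w)) (a~a' g) (b~b' g)
    approx-resp (so k) a~a' b~b' = InD-mono 𝒟 λ g a≈b →
      let module E = IsEquivalence (TrueGE.approx-equiv (tge g) (so k)) in
      E.trans (Indist⇒approx (Indist.sym (so k) a~a') g) (E.trans a≈b (Indist⇒approx b~b' g))

    lookup-at : ∀ {k} γ (qs : Vec (Term S fo) (suc k)) g i →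
                lookup (at 𝒟 U (map (λ q → lower (⟦_⟧ Π q γ)) qs) g) i
                  ≡ lower (⟦_⟧ Π (lookup qs i) γ) g
    lookup-at γ qs g i = begin
      lookup (map (λ a → a g) (map (λ q → lower (⟦_⟧ Π q γ)) qs)) i
        ≡⟨ lookup-map i (λ a → a g) (map (λ q → lower (⟦_⟧ Π q γ)) qs) ⟩
      lookup (map (λ q → lower (⟦_⟧ Π q γ)) qs) i g
        ≡⟨ cong (λ a → a g) (lookup-map i (λ q → lower (⟦_⟧ Π q γ)) qs) ⟩
      lower (⟦_⟧ Π (lookup qs i) γ) g ∎
      where open ≡-Reasoning

    bel-resp : ∀ {k} {γ γ'} → IndistEval γ γ' →
               (θ : Θ S (so k)) (qs : Vec (Term S fo) (suc k)) (r : Term S (so k)) →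
               Sat Π (memF θ qs r) γ → Sat Π (memF θ qs r) γ'
    bel-resp {k} {γ} {γ'} γ~γ' θ qs r = InD-mono 𝒟 λ g →
      to (TrueGE.bel-cong (tge g) k _ _ _ _ (same-coordinates g)
                                            (Indist⇒approx (term-cong γ~γ' r) g))
      where
      same-coordinates : ∀ g i →
        approx (U g) fo (lift (lookup (at 𝒟 U (map (λ q → lower (⟦_⟧ Π q γ)) qs) g) i))
                        (lift (lookup (at 𝒟 U (map (λ q → lower (⟦_⟧ Π q γ')) qs) g) i))
      same-coordinates g i = IsSystem.approx-id (sys g) fo _ _ (cong lift
        (trans (lookup-at γ qs g i)
        (trans (term-cong γ~γ' (lookup qs i) g) (sym (lookup-at γ' qs g i)))))

    Sat-invariant : ∀ φ {γ γ'} → IndistEval γ γ' → Sat Π φ γ ⇔ Sat Π φ γ'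
    Sat-invariant (eqF {σ} _ q r) {γ} {γ'} γ~γ' =
      mk⇔ (approx-resp σ (term-cong γ~γ' q) (term-cong γ~γ' r))
          (approx-resp σ (term-cong γ'~γ q) (term-cong γ'~γ r))
      where
      γ'~γ : IndistEval γ' γ
      γ'~γ = IndistEval-sym γ~γ'
    Sat-invariant (memF θ qs r) γ~γ' =
      mk⇔ (bel-resp γ~γ' θ qs r) (bel-resp (IndistEval-sym γ~γ') θ qs r)
    Sat-invariant (notF φ) γ~γ' = ¬-cong-⇔ (Sat-invariant φ γ~γ')
    Sat-invariant (andF φ ψ) γ~γ' = Sat-invariant φ γ~γ' ×-⇔ Sat-invariant ψ γ~γ'
    Sat-invariant (orF φ ψ) γ~γ' = Sat-invariant φ γ~γ' ⊎-⇔ Sat-invariant ψ γ~γ'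
    Sat-invariant (impF φ ψ) γ~γ' = →-cong-⇔ (Sat-invariant φ γ~γ') (Sat-invariant ψ γ~γ')
    Sat-invariant (exF τ _ n φ) γ~γ' =
      mk⇔ (λ (v , s) → v , to   (Sat-invariant φ (update-cong γ~γ' τ n (Indist.refl τ))) s)
          (λ (v , s) → v , from (Sat-invariant φ (update-cong γ~γ' τ n (Indist.refl τ))) s)
    Sat-invariant (allF τ _ n φ) γ~γ' =
      mk⇔ (λ s v → to   (Sat-invariant φ (update-cong γ~γ' τ n (Indist.refl τ))) (s v))
          (λ s v → from (Sat-invariant φ (update-cong γ~γ' τ n (Indist.refl τ))) (s v))

proposition5 : (S : Signature) (F : Set) (𝒟 : Filter F) (ψ : Formula S) →
    Infrafiltrated 𝒟 ψ →
    (τ : Ty) (θ : Θ S τ) (n : ℕ) → Infrafiltrated 𝒟 (exF τ θ n ψ)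
proposition5 S F 𝒟 ψ ψ-inf τ θ n U sys tge γs = mk⇔ product⇒factors factors⇒product
  where
  open Indistinguishability 𝒟 U

  product⇒factors : Sat Π (exF τ θ n ψ) (cross 𝒟 U γs) →
                    InD 𝒟 (λ g → Sat (U g) (exF τ θ n ψ) (γs g))
  product⇒factors (v , v-sat) =
    InD-mono 𝒟 (λ g sat → proj τ v g , sat)
             (to (ψ-inf U sys tge (update-each γs τ n (proj τ v)))
                 (to (Sat-invariant sys tge ψ v~coordinates) v-sat))
    where
    v~coordinates : IndistEval (update (cross 𝒟 U γs) τ n v) (cross 𝒟 U (update-each γs τ n (proj τ v)))
    v~coordinates = IndistEval-trans
      (update-cong (λ σ m → Indist.refl σ) τ n (crossVal-proj τ v))
      (IndistEval-sym (cross-update γs τ n (proj τ v)))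

  factors⇒product : InD 𝒟 (λ g → Sat (U g) (exF τ θ n ψ) (γs g)) →
                    Sat Π (exF τ θ n ψ) (cross 𝒟 U γs)
  factors⇒product witnesses =
    let (ws , ws-sat) = InD-choice 𝒟 (λ f → γs f τ n) witnesses
    in crossVal τ ws ,
       to (Sat-invariant sys tge ψ (cross-update γs τ n ws))
          (from (ψ-inf U sys tge (update-each γs τ n ws)) ws-sat)
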